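{- For any integers $c\ge 2$ and $t\ge 0$, $\chi(t+1,c+1)\ge \chi(t,c)+1$.
   Context: A hypergraph $G$ consists of a finite vertex set together with a collection of subsets of it (edges). For an integer $c\ge 2$, a $c$-strong coloring of $G$ is an assignment of colors to its vertices such that every edge $e$ of $G$ contains vertices of at least $\min\{c,|e|\}$ distinct colors. $G$ is $t$-intersecting if every two edges of $G$ have at least $t$ vertices in common. For integers $c\ge 2$, $t\ge 0$, $\chi(t,c)$ denotes the minimum number of colors that suffices to $c$-strong color every $t$-intersecting hypergraph ($\infty$ if no finite number suffices). -}

module Defs where

open import Data.Nat using (ℕ; zero; suc; _+_; _≤_; _<_; _⊓_)
open import Data.Fin using (Fin; _≟_)
open import Data.Fin.Subset using (Subset; _∩_; ∣_∣)
open import Data.Bool using (Bool; true; false; _∧_)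
open import Data.List using (List; allFin)
open import Data.Bool.ListAction using (any)
open import Data.List.Membership.Propositional using (_∈_)
open import Data.Vec using (lookup; tabulate)
open import Data.Maybe using (Maybe; just; nothing)
open import Data.Empty using (⊥)
open import Data.Unit using (⊤)
open import Data.Product using (∃)
open import Relation.Nullary using (¬_)
open import Relation.Nullary.Decidable using (⌊_⌋)
open import Relation.Binary.PropositionalEquality using (_≡_)

-- Repetitions in the list are
-- irrelevant for all notions below (they only use membership).
record Hypergraph (n : ℕ) : Set where
  constructor hypergraph
  field
    edges : List (Subset n)
open Hypergraph public

IsTIntersecting : ∀ {n} → ℕ → Hypergraph n → Set
IsTIntersecting t G =
  ∀ {e e′} → e ∈ edges G → e′ ∈ edges G → ¬ (e ≡ e′) → t ≤ ∣ e ∩ e′ ∣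

colorsOn : ∀ {n k} → (Fin n → Fin k) → Subset n → Subset k
colorsOn {n} f e = tabulate (λ j → any (λ v → lookup e v ∧ ⌊ f v ≟ j ⌋) (allFin n))

IsStrongColoring : ∀ {n k} → ℕ → Hypergraph n → (Fin n → Fin k) → Set
IsStrongColoring c G f = ∀ {e} → e ∈ edges G → c ⊓ ∣ e ∣ ≤ ∣ colorsOn f e ∣

Suffices : ℕ → ℕ → ℕ → Set
Suffices t c k = ∀ n (G : Hypergraph n) → IsTIntersecting t G →
  ∃ λ (f : Fin n → Fin k) → IsStrongColoring c G f

ℕ∞ : Set
ℕ∞ = Maybe ℕ

∞ : ℕ∞
∞ = nothing

_+∞1 : ℕ∞ → ℕ∞
just m +∞1 = just (suc m)
nothing +∞1 = nothing

_≤∞_ : ℕ∞ → ℕ∞ → Set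
just m ≤∞ just n = m ≤ n
just m ≤∞ nothing = ⊤
nothing ≤∞ just n = ⊥
nothing ≤∞ nothing = ⊤

-- IsChi t c x : x = χ(t,c), the minimum number of colors that suffices,
-- or ∞ if no finite number suffices.
data IsChi (t c : ℕ) : ℕ∞ → Set where
  finite : ∀ m → Suffices t c m → (∀ k → k < m → ¬ Suffices t c k) → IsChi t c (just m)
  infinite : (∀ k → ¬ Suffices t c k) → IsChi t c ∞

-- Add a new vertex to every edge of a t-intersecting hypergraph G: the result is
-- (t+1)-intersecting, so it has a (c+1)-strong colouring with χ(t+1,c+1) colours.
-- The new vertex contributes one colour a to each edge; deleting it and recolouring
-- its class with some other colour leaves a c-strong colouring of G, since each edge
-- loses at most the colour a.  This needs at least two colours on the cone, which a
-- single 2-element edge forces when c ≥ 2.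
module Submission where

open import Defs
open import Data.Nat using (ℕ; zero; suc; _≤_; _≤?_; s≤s)
open import Data.Nat.Properties using (≤-trans; ≤-pred; n≤1+n; ≰⇒>)
open import Data.Fin using (Fin; zero; suc; punchIn; punchOut; _≟_)
open import Data.Fin.Properties using (punchIn-punchOut)
open import Data.Fin.Subset using (Subset; _⊆_; ∣_∣; ⊤; inside; outside)
  renaming (_∈_ to _∈ₛ_)
open import Data.Fin.Subset.Properties using (drop-there; p⊆q⇒∣p∣≤∣q∣)
open import Data.Bool.Properties using (T-≡; T-∧)
open import Data.List using ([]; _∷_; allFin; map)
open import Data.List.Membership.Propositional using (_∈_; lose)
open import Data.List.Membership.Propositional.Properties using (∈-map⁺; ∈-map⁻; ∈-allFin)
open import Data.List.Relation.Unary.Any using (here; satisfied)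
open import Data.List.Relation.Unary.Any.Properties using (any⁺; any⁻)
open import Data.Vec using (_∷_; insertAt)
open import Data.Vec.Properties using
  ([]=⇒lookup; lookup⇒[]=; lookup∘tabulate; insertAt-lookup; insertAt-punchIn)
open import Data.Maybe using (just; nothing)
open import Data.Empty using (⊥-elim)
open import Data.Unit using (tt)
open import Data.Product using (∃; _×_; _,_; proj₁)
open import Function.Bundles using (Equivalence)
open import Relation.Nullary using (¬_; yes; no; contradiction)
open import Relation.Nullary.Decidable using (toWitness; fromWitness)
open import Relation.Binary.PropositionalEquality using (_≡_; refl; sym; trans; cong; subst)

open Equivalence using (to; from)

colorsOn-sound : ∀ {n k} (f : Fin n → Fin k) (e : Subset n) {j} →
  j ∈ₛ colorsOn f e → ∃ λ v → v ∈ₛ e × f v ≡ j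
colorsOn-sound {n} f e {j} j∈
  with satisfied (any⁻ _ (allFin n) (from T-≡ (trans (sym (lookup∘tabulate _ j)) ([]=⇒lookup j∈))))
... | v , Tv = let Tv∈e , Tfv≡j = to T-∧ Tv in
  v , lookup⇒[]= v e (to T-≡ Tv∈e) , toWitness Tfv≡j

colorsOn-complete : ∀ {n k} (f : Fin n → Fin k) {e : Subset n} {v} →
  v ∈ₛ e → f v ∈ₛ colorsOn f e
colorsOn-complete {n} f {e} {v} v∈e = lookup⇒[]= (f v) _ (trans (lookup∘tabulate _ (f v))
  (to T-≡ (any⁺ _ (lose (∈-allFin v) (from T-∧ (from T-≡ ([]=⇒lookup v∈e) , fromWitness refl))))))

∣insertAt-inside∣ : ∀ {n} (p : Subset n) i → ∣ insertAt p i inside ∣ ≡ suc ∣ p ∣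
∣insertAt-inside∣ p zero = refl
∣insertAt-inside∣ (inside ∷ p) (suc i) = cong suc (∣insertAt-inside∣ p i)
∣insertAt-inside∣ (outside ∷ p) (suc i) = ∣insertAt-inside∣ p i

collapse : ∀ {k} → Fin (suc (suc k)) → Fin (suc (suc k)) → Fin (suc k)
collapse a x with a ≟ x
... | yes _ = zero
... | no a≢x = punchOut a≢x

punchIn-collapse : ∀ {k} {a x : Fin (suc (suc k))} → ¬ a ≡ x → punchIn a (collapse a x) ≡ x
punchIn-collapse {a = a} {x} a≢x with a ≟ x
... | yes a≡x = contradiction a≡x a≢x
... | no a≢x′ = punchIn-punchOut a≢x′

cone : ∀ {n} → Hypergraph n → Hypergraph (suc n)
cone G = hypergraph (map (inside ∷_) (edges G))

cone-intersecting : ∀ {n t} {G : Hypergraph n} →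
  IsTIntersecting t G → IsTIntersecting (suc t) (cone G)
cone-intersecting int e∈ e′∈ e≢e′ with ∈-map⁻ (inside ∷_) e∈ | ∈-map⁻ (inside ∷_) e′∈
... | _ , e∈G , refl | _ , e′∈G , refl = s≤s (int e∈G e′∈G (λ { refl → e≢e′ refl }))

uncone : ∀ {n k} → (Fin (suc n) → Fin (suc (suc k))) → Fin n → Fin (suc k)
uncone g v = collapse (g zero) (g (suc v))

colorsOn-cone : ∀ {n k} (g : Fin (suc n) → Fin (suc (suc k))) (e : Subset n) →
  colorsOn g (inside ∷ e) ⊆ insertAt (colorsOn (uncone g) e) (g zero) inside
colorsOn-cone g e {j} j∈ with g zero ≟ j | colorsOn-sound g (inside ∷ e) j∈
... | yes refl | _ = lookup⇒[]= _ _ (insertAt-lookup _ (g zero) inside)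
... | no a≢j | zero , _ , refl = contradiction refl a≢j
... | no a≢j | suc v , v∈e , refl =
  subst (_∈ₛ insertAt (colorsOn (uncone g) e) (g zero) inside) (punchIn-collapse a≢j)
    (lookup⇒[]= _ _ (trans (insertAt-punchIn _ (g zero) inside _)
      ([]=⇒lookup (colorsOn-complete (uncone g) (drop-there v∈e)))))

uncone-strong : ∀ {n k c} {G : Hypergraph n} (g : Fin (suc n) → Fin (suc (suc k))) →
  IsStrongColoring (suc c) (cone G) g → IsStrongColoring c G (uncone g)
-- ≤-pred applies because (c+1) ⊓ (|e|+1) reduces to suc (c ⊓ |e|).
uncone-strong g strong {e} e∈G = ≤-pred (≤-trans (strong (∈-map⁺ (inside ∷_) e∈G))
  (subst (∣ colorsOn g (inside ∷ e) ∣ ≤_) (∣insertAt-inside∣ (colorsOn (uncone g) e) (g zero))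
    (p⊆q⇒∣p∣≤∣q∣ (colorsOn-cone g e))))

Suffices-uncone : ∀ {t c k} → Suffices (suc t) (suc c) (suc (suc k)) → Suffices t c (suc k)
Suffices-uncone suffices n G int with suffices (suc n) (cone G) (cone-intersecting int)
... | g , strong = uncone g , uncone-strong g strong

¬Suffices-zero : ∀ {t c} → ¬ Suffices t c 0
¬Suffices-zero suffices with proj₁ (suffices 1 (hypergraph []) (λ ())) zero
... | ()

single-intersecting : ∀ {n t} (e : Subset n) → IsTIntersecting t (hypergraph (e ∷ []))
single-intersecting e (here refl) (here refl) e≢e′ = contradiction refl e≢e′

¬Suffices-one : ∀ {t c} → 2 ≤ c → ¬ Suffices t c 1
¬Suffices-one {c = suc zero} (s≤s ())
¬Suffices-one {c = suc (suc c)} _ suffices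
  with suffices 2 (hypergraph (⊤ ∷ [])) (single-intersecting ⊤)
... | f , strong with f zero | f (suc zero) | strong (here refl)
... | zero | zero | s≤s ()

IsChi-≤ : ∀ {t c k x} → IsChi t c x → Suffices t c k → x ≤∞ just k
IsChi-≤ {k = k} (finite m _ minimal) suffices with m ≤? k
... | yes m≤k = m≤k
... | no m≰k = contradiction suffices (minimal k (≰⇒> m≰k))
IsChi-≤ (infinite none) suffices = none _ suffices

+∞1-mono : ∀ {x k} → x ≤∞ just k → (x +∞1) ≤∞ just (suc k)
+∞1-mono {just _} x≤k = s≤s x≤k

mainTheorem2 : ∀ (c t : ℕ) → 2 ≤ c → ∀ (x y : ℕ∞) →
    IsChi t c x → IsChi (suc t) (suc c) y → (x +∞1) ≤∞ y
mainTheorem2 c t 2≤c x nothing χx χy with x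
... | just _ = tt
... | nothing = tt
mainTheorem2 c t 2≤c x (just .zero) χx (finite zero suffices _) =
  ⊥-elim (¬Suffices-zero suffices)
mainTheorem2 c t 2≤c x (just .1) χx (finite (suc zero) suffices _) =
  ⊥-elim (¬Suffices-one (≤-trans 2≤c (n≤1+n c)) suffices)
mainTheorem2 c t 2≤c x (just .(suc (suc k))) χx (finite (suc (suc k)) suffices _) =
  +∞1-mono (IsChi-≤ χx (Suffices-uncone suffices))
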